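{- Let $G$ be a finite, simple, connected, bridgeless cubic graph with an even number of edges. Then every edge of the line graph $L(G)$ belongs to some perfect matching of $L(G)$.
   Context: The line graph $L(G)$ has vertex set $E(G)$, two vertices adjacent when the corresponding edges of $G$ share an end-vertex. -}

module Defs where

open import Data.Nat using (ℕ; _<_; _<ᵇ_)
open import Data.Fin using (Fin; toℕ; _≟_)
open import Data.Bool using (Bool; true; false; T; _∧_; _∨_; not; if_then_else_)
open import Data.List using (List; []; _∷_; [_]; concatMap; length; allFin)
open import Data.Product using (Σ; Σ-syntax; _×_; _,_; proj₁; proj₂)
open import Data.Sum using (_⊎_)
open import Relation.Nullary using (¬_)
open import Relation.Nullary.Decidable using (⌊_⌋)
open import Relation.Binary.PropositionalEquality using (_≡_)

record SimpleGraph (n : ℕ) : Set where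
  field
    adj    : Fin n → Fin n → Bool
    sym    : ∀ u v → adj u v ≡ adj v u
    irrefl : ∀ u → adj u u ≡ false
open SimpleGraph public

data Walk {n : ℕ} (a : Fin n → Fin n → Bool) : Fin n → Fin n → Set where
  [] : ∀ {u} → Walk a u u
  _∷_ : ∀ {u v w} → T (a u v) → Walk a v w → Walk a u w

ConnectedAdj : {n : ℕ} → (Fin n → Fin n → Bool) → Set
ConnectedAdj {n} a = (u v : Fin n) → Walk a u v

Connected : {n : ℕ} → SimpleGraph n → Set
Connected G = ConnectedAdj (adj G)

-- Edges of G: an edge {u,v} is stored canonically as (u , v) with u < v.
IsEdge : {n : ℕ} → SimpleGraph n → Fin n × Fin n → Set
IsEdge G (u , v) = (toℕ u < toℕ v) × T (adj G u v)

Edge : {n : ℕ} → SimpleGraph n → Set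
Edge G = Σ _ (IsEdge G)

deleteEdge : {n : ℕ} → SimpleGraph n → Fin n × Fin n → Fin n → Fin n → Bool
deleteEdge G (a , b) u v =
  adj G u v ∧ not ((⌊ u ≟ a ⌋ ∧ ⌊ v ≟ b ⌋) ∨ (⌊ u ≟ b ⌋ ∧ ⌊ v ≟ a ⌋))

-- Bridgeless: deleting any single edge leaves the graph connected
-- (for connected G this says no edge is a bridge).
Bridgeless : {n : ℕ} → SimpleGraph n → Set
Bridgeless G = (e : Edge G) → ConnectedAdj (deleteEdge G (proj₁ e))

Cubic : {n : ℕ} → SimpleGraph n → Set
Cubic {n} G = (v : Fin n) → Σ[ x ∈ Fin n ] Σ[ y ∈ Fin n ] Σ[ z ∈ Fin n ]
  ( T (adj G v x) × T (adj G v y) × T (adj G v z)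
  × ¬ (x ≡ y) × ¬ (x ≡ z) × ¬ (y ≡ z)
  × ((w : Fin n) → T (adj G v w) → (w ≡ x) ⊎ (w ≡ y) ⊎ (w ≡ z)) )

edgeList : {n : ℕ} → SimpleGraph n → List (Fin n × Fin n)
edgeList {n} G = concatMap (λ u → concatMap (λ v →
  if adj G u v ∧ (toℕ u <ᵇ toℕ v) then [ (u , v) ] else []) (allFin n)) (allFin n)

numEdges : {n : ℕ} → SimpleGraph n → ℕ
numEdges G = length (edgeList G)

ShareEnd : {n : ℕ} → Fin n × Fin n → Fin n × Fin n → Set
ShareEnd (a , b) (c , d) = (a ≡ c) ⊎ (a ≡ d) ⊎ (b ≡ c) ⊎ (b ≡ d)

LAdj : {n : ℕ} (G : SimpleGraph n) → Edge G → Edge G → Set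
LAdj G e f = ¬ (e ≡ f) × ShareEnd (proj₁ e) (proj₁ f)

-- A set of edges is represented as a symmetric
-- relation M (M x y means the edge {x,y} is in the set).

IsPerfectMatching : {V : Set} → (V → V → Set) → (V → V → Set) → Set
IsPerfectMatching {V} Adj M =
  ((x y : V) → M x y → Adj x y)
  × ((x y : V) → M x y → M y x)
  × ((x : V) → Σ[ y ∈ V ] (M x y × ((z : V) → M x z → z ≡ y)))

module Submission where

-- Orient G so that every vertex has even in-degree.  In a cubic graph
-- every vertex then has in-degree 0 or 2, and matching each edge with the
-- other edge having the same head is a perfect matching of L(G).  Given
-- adjacent edges va and vb of L(G) we need such an orientation with a → v and
-- b → v.  Start from any orientation directing exactly va and vb into v, and
-- repair the parity of every other vertex w ≠ a by reversing a path from w to a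
-- in G − v: this toggles the parity at w and a only and does not touch the
-- edges at v.  Such paths exist because G is bridgeless.  Finally a is even as
-- well, since modulo 2 the in-degrees always add up to |E(G)|.

open import Defs hiding (sym)
open import Data.Nat using (ℕ; zero; suc; _*_; _+_; _<ᵇ_)
open import Data.Nat.Properties using (<-irrelevant; <-asym; <-cmp)
open import Data.Nat.Divisibility using (_∣_; divides)
open import Data.Fin using (Fin; zero; suc; toℕ; _≟_)
open import Data.Fin.Properties using (toℕ-injective; suc-injective)
open import Data.Bool using (Bool; true; false; T; not; _∧_; _∨_; _xor_; if_then_else_)
open import Data.Bool.Properties
  using ( xor-∧-commutativeRing; xor-assoc; xor-identityʳ; xor-annihilates-not
        ; not-distribˡ-xor; not-involutive; ∧-distribˡ-xor; ∧-distribʳ-xor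
        ; ∧-zeroʳ; ∧-identityʳ; ∧-comm; ∨-zeroʳ; xor-comm; xor-same; T-irrelevant; T-≡; T-∧ )
open import Data.List using (List; []; _∷_; [_]; length; concatMap; tabulate; allFin)
open import Data.List.Properties using (length-++)
open import Data.List.Relation.Unary.All as All using (All; []; _∷_)
open import Data.List.Membership.Propositional.Properties using (∈-allFin)
open import Data.Product using (Σ-syntax; _×_; _,_; proj₁; proj₂)
open import Data.Sum using (_⊎_; inj₁; inj₂; [_,_]′; swap)
open import Data.Empty using (⊥; ⊥-elim)
open import Function using (_∘_; id)
open import Function.Bundles using (Equivalence)
open import Relation.Nullary using (¬_; Dec; yes; no)
open import Relation.Nullary.Decidable using (⌊_⌋)
open import Relation.Binary using (Symmetric; Transitive; tri<; tri≈; tri>)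
open import Relation.Binary.PropositionalEquality hiding ([_])
open import Relation.Binary.Construct.Closure.ReflexiveTransitive
  using (Star; ε; _◅_; _◅◅_) renaming (reverse to reverseStar)
open import Algebra.Bundles using (CommutativeRing)
open import Algebra.Properties.CommutativeMonoid.Sum
  (CommutativeRing.+-commutativeMonoid xor-∧-commutativeRing)
  using (sum-cong-≗; sum-replicate-zero; ∑-distrib-+; ∑-comm)
  renaming (sum to ⨁)

xor-cancel : ∀ r d → r xor (r xor d) ≡ d
xor-cancel false d = refl
xor-cancel true d = not-involutive d

xor-cancelˡ : ∀ w u t → (w xor u) xor (w xor t) ≡ u xor t
xor-cancelˡ false u t = refl
xor-cancelˡ true u t = xor-annihilates-not u t

xor-false⇒≡ : ∀ {x y} → x xor y ≡ false → x ≡ y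
xor-false⇒≡ {false} refl = refl
xor-false⇒≡ {true} {false} ()
xor-false⇒≡ {true} {true} _ = refl

true-xor≡false : ∀ {x} → true xor x ≡ false → x ≡ true
true-xor≡false {true} _ = refl

parity : ℕ → Bool
parity zero = false
parity (suc m) = not (parity m)

parity-+ : ∀ m k → parity (m + k) ≡ parity m xor parity k
parity-+ zero k = refl
parity-+ (suc m) k = trans (cong not (parity-+ m k)) (not-distribˡ-xor (parity m) (parity k))

parity-even : ∀ {m} → 2 ∣ m → parity m ≡ false
parity-even (divides q refl) = double q
  where
    double : ∀ q → parity (q * 2) ≡ false
    double zero = refl
    double (suc q) = trans (not-involutive _) (double q)

parity-concatMap : ∀ {A B : Set} {m} (g : A → List B) (f : Fin m → A) →
  parity (length (concatMap g (tabulate f))) ≡ ⨁ (λ u → parity (length (g (f u))))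
parity-concatMap {m = zero} g f = refl
parity-concatMap {m = suc m} g f =
  trans (cong parity (length-++ (g (f zero))))
        (trans (parity-+ (length (g (f zero))) _)
               (cong (parity (length (g (f zero))) xor_) (parity-concatMap g (f ∘ suc))))

parity-singleton : ∀ {A : Set} b (x : A) → parity (length (if b then [ x ] else [])) ≡ b
parity-singleton true x = refl
parity-singleton false x = refl

⨁-zero : ∀ {m} (f : Fin m → Bool) → (∀ u → f u ≡ false) → ⨁ f ≡ false
⨁-zero {m} f vanish = trans (sum-cong-≗ vanish) (sum-replicate-zero m)

⨁-supported : ∀ {m} (f : Fin m → Bool) (p : Fin m) →
  (∀ u → u ≢ p → f u ≡ false) → ⨁ f ≡ f p
⨁-supported f zero vanish =
  trans (cong (f zero xor_) (⨁-zero (f ∘ suc) (λ u → vanish (suc u) λ ())))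
        (xor-identityʳ (f zero))
⨁-supported f (suc p) vanish =
  trans (cong (_xor ⨁ (f ∘ suc)) (vanish zero λ ()))
        (⨁-supported (f ∘ suc) p (λ u u≢p → vanish (suc u) (u≢p ∘ suc-injective)))

-- Modulo 2 the off-diagonal entries of a symmetric matrix cancel in pairs,
-- so its total is its trace.
⨁-symmetric : ∀ {m} (d : Fin m → Fin m → Bool) → (∀ u w → d u w ≡ d w u) →
  ⨁ (λ u → ⨁ (λ w → d u w)) ≡ ⨁ (λ u → d u u)
⨁-symmetric {zero} d symm = refl
⨁-symmetric {suc m} d symm = begin
  (d zero zero xor row) xor ⨁ (λ u → d (suc u) zero xor ⨁ (λ w → d (suc u) (suc w)))
    ≡⟨ cong ((d zero zero xor row) xor_) (∑-distrib-+ (λ u → d (suc u) zero) _) ⟩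
  (d zero zero xor row) xor (column xor rest)
    ≡⟨ cong (λ c → (d zero zero xor row) xor (c xor rest)) column≡row ⟩
  (d zero zero xor row) xor (row xor rest)
    ≡⟨ xor-assoc (d zero zero) row (row xor rest) ⟩
  d zero zero xor (row xor (row xor rest))
    ≡⟨ cong (d zero zero xor_) (xor-cancel row rest) ⟩
  d zero zero xor rest
    ≡⟨ cong (d zero zero xor_) (⨁-symmetric (λ u w → d (suc u) (suc w))
                                              (λ u w → symm (suc u) (suc w))) ⟩
  d zero zero xor ⨁ (λ u → d (suc u) (suc u)) ∎
  where
    open ≡-Reasoning
    row = ⨁ (λ w → d zero (suc w))
    column = ⨁ (λ u → d (suc u) zero)
    rest = ⨁ (λ u → ⨁ (λ w → d (suc u) (suc w)))
    column≡row : column ≡ row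
    column≡row = sum-cong-≗ (λ u → symm (suc u) zero)

_==_ : ∀ {m} → Fin m → Fin m → Bool
u == w = ⌊ u ≟ w ⌋

==-refl : ∀ {m} (u : Fin m) → u == u ≡ true
==-refl u with u ≟ u
... | yes _ = refl
... | no u≢u = ⊥-elim (u≢u refl)

≢⇒==false : ∀ {m} {u w : Fin m} → u ≢ w → u == w ≡ false
≢⇒==false {u = u} {w} u≢w with u ≟ w
... | yes u≡w = ⊥-elim (u≢w u≡w)
... | no _ = refl

⨁-point : ∀ {m} (p : Fin m) (h : Fin m → Bool) → ⨁ (λ u → u == p ∧ h u) ≡ h p
⨁-point p h = trans (⨁-supported _ p off) (cong (_∧ h p) (==-refl p))
  where
    off : ∀ u → u ≢ p → u == p ∧ h u ≡ false
    off u u≢p = cong (_∧ h u) (≢⇒==false u≢p)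

⨁-indicator : ∀ {m} (p : Fin m) → ⨁ (_== p) ≡ true
⨁-indicator p = trans (⨁-supported (_== p) p (λ _ → ≢⇒==false)) (==-refl p)

triangle : ∀ {A : Set} {_~_ : A → A → Set} → Symmetric _~_ → Transitive _~_ →
  ∀ {x y z} → (x ~ y) ⊎ (x ~ z) → (y ~ x) ⊎ (y ~ z) → (z ~ x) ⊎ (z ~ y) →
  (y ~ x) × (z ~ x)
triangle {_~_ = _~_} sym~ trans~ {x} {y} {z} fromX fromY fromZ = y~x fromY fromZ fromX , z~x fromZ
  where
    y~x : (y ~ x) ⊎ (y ~ z) → (z ~ x) ⊎ (z ~ y) → (x ~ y) ⊎ (x ~ z) → y ~ x
    y~x (inj₁ yx) _ _ = yx
    y~x (inj₂ yz) (inj₁ zx) _ = trans~ yz zx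
    y~x (inj₂ _) (inj₂ _) (inj₁ xy) = sym~ xy
    y~x (inj₂ yz) (inj₂ _) (inj₂ xz) = trans~ yz (sym~ xz)
    z~x : (z ~ x) ⊎ (z ~ y) → z ~ x
    z~x (inj₁ zx) = zx
    z~x (inj₂ zy) = trans~ zy (y~x fromY fromZ fromX)

<ᵇ-antisym : ∀ i j → i ≢ j → (i <ᵇ j) ≡ not (j <ᵇ i)
<ᵇ-antisym zero zero i≢j = ⊥-elim (i≢j refl)
<ᵇ-antisym zero (suc j) _ = refl
<ᵇ-antisym (suc i) zero _ = refl
<ᵇ-antisym (suc i) (suc j) i≢j = <ᵇ-antisym i j (i≢j ∘ cong suc)

module _ {n : ℕ} (G : SimpleGraph n) where

  adj-sym : ∀ {u w} → T (adj G u w) → T (adj G w u)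
  adj-sym {u} {w} = subst T (SimpleGraph.sym G u w)

  adj⇒≢ : ∀ {u w} → T (adj G u w) → u ≢ w
  adj⇒≢ {u} h refl = subst T (irrefl G u) h

  adj-true : ∀ {u w} → T (adj G u w) → adj G u w ≡ true
  adj-true = Equivalence.to T-≡

  Ends : Edge G → Fin n → Fin n → Set
  Ends E p q = (proj₁ E ≡ (p , q)) ⊎ (proj₁ E ≡ (q , p))

  ends-swap : ∀ {E p q} → Ends E p q → Ends E q p
  ends-swap (inj₁ e) = inj₂ e
  ends-swap (inj₂ e) = inj₁ e

  edgeOf : ∀ u w → T (adj G u w) → Σ[ E ∈ Edge G ] Ends E u w
  edgeOf u w h with <-cmp (toℕ u) (toℕ w)
  ... | tri< u<w _ _ = ((u , w) , u<w , h) , inj₁ refl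
  ... | tri≈ _ u≡w _ = ⊥-elim (adj⇒≢ h (toℕ-injective u≡w))
  ... | tri> _ _ w<u = ((w , u) , w<u , adj-sym h) , inj₂ refl

  edge-≡ : (E E' : Edge G) → proj₁ E ≡ proj₁ E' → E ≡ E'
  edge-≡ (pq , l , h) (.pq , l' , h') refl =
    cong₂ (λ l h → pq , l , h) (<-irrelevant l l') (T-irrelevant h h')

  ends-unique : ∀ {p q} (E E' : Edge G) → Ends E p q → Ends E' p q → E ≡ E'
  ends-unique E E' (inj₁ e) (inj₁ e') = edge-≡ E E' (trans e (sym e'))
  ends-unique E E' (inj₂ e) (inj₂ e') = edge-≡ E E' (trans e (sym e'))
  ends-unique (_ , l , _) (_ , l' , _) (inj₁ refl) (inj₂ refl) = ⊥-elim (<-asym l l')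
  ends-unique (_ , l , _) (_ , l' , _) (inj₂ refl) (inj₁ refl) = ⊥-elim (<-asym l l')

  ends-adj : ∀ {E p q} → Ends E p q → T (adj G p q)
  ends-adj {(_ , _) , _ , cd} (inj₁ refl) = cd
  ends-adj {(_ , _) , _ , cd} (inj₂ refl) = adj-sym cd

  distinctEnds : ∀ {e f v a b} → e ≢ f → Ends e v a → Ends f v b → a ≢ b
  distinctEnds {e} {f} e≢f ends-e ends-f refl = e≢f (ends-unique e f ends-e ends-f)

  commonVertex : (e f : Edge G) → ShareEnd (proj₁ e) (proj₁ f) →
    Σ[ v ∈ Fin n ] Σ[ a ∈ Fin n ] Σ[ b ∈ Fin n ]
      (Ends e v a × Ends f v b × T (adj G v a) × T (adj G v b))
  commonVertex ((p , q) , _ , pq) ((.p , s) , _ , ps) (inj₁ refl) =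
    p , q , s , inj₁ refl , inj₁ refl , pq , ps
  commonVertex ((p , q) , _ , pq) ((r , .p) , _ , rp) (inj₂ (inj₁ refl)) =
    p , q , r , inj₁ refl , inj₂ refl , pq , adj-sym rp
  commonVertex ((p , q) , _ , pq) ((.q , s) , _ , qs) (inj₂ (inj₂ (inj₁ refl))) =
    q , p , s , inj₂ refl , inj₁ refl , adj-sym pq , qs
  commonVertex ((p , q) , _ , pq) ((r , .q) , _ , rq) (inj₂ (inj₂ (inj₂ refl))) =
    q , p , r , inj₂ refl , inj₂ refl , adj-sym pq , adj-sym rq

  deleteEdge⊆adj : ∀ e {u w} → T (deleteEdge G e u w) → T (adj G u w)
  deleteEdge⊆adj e = proj₁ ∘ Equivalence.to T-∧

  deleted-pair : ∀ a b → deleteEdge G (a , b) a b ≡ false × deleteEdge G (a , b) b a ≡ false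
  deleted-pair a b rewrite ==-refl a | ==-refl b =
    ∧-zeroʳ (adj G a b) ,
    trans (cong (λ c → adj G b a ∧ not c) (∨-zeroʳ _)) (∧-zeroʳ (adj G b a))

  deleteEdge-removes : ∀ {E p q} → Ends E p q → ¬ T (deleteEdge G (proj₁ E) q p)
  deleteEdge-removes {E} {p} {q} (inj₁ eq) rewrite eq = subst T (proj₂ (deleted-pair p q))
  deleteEdge-removes {E} {p} {q} (inj₂ eq) rewrite eq = subst T (proj₁ (deleted-pair q p))

  -- Orientations.  o u w says that the pair {u,w} is directed u → w; the
  -- orientation is consistent when each edge is directed exactly one way.

  Orientation : Set
  Orientation = Fin n → Fin n → Bool

  Antisymmetric : Orientation → Set
  Antisymmetric o = ∀ u w → T (adj G u w) → o u w ≡ not (o w u)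

  oddIn : Orientation → Fin n → Bool
  oddIn o w = ⨁ (λ u → adj G u w ∧ o u w)

  ascending : Orientation
  ascending u w = toℕ u <ᵇ toℕ w

  ascending-antisym : Antisymmetric ascending
  ascending-antisym u w h = <ᵇ-antisym (toℕ u) (toℕ w) (adj⇒≢ h ∘ toℕ-injective)

  parity-numEdges : parity (numEdges G) ≡ ⨁ (λ u → ⨁ (λ w → adj G u w ∧ ascending u w))
  parity-numEdges =
    trans (parity-concatMap rowList id)
          (sum-cong-≗ (λ u → trans (parity-concatMap (entry u) id)
                                    (sum-cong-≗ (λ w → single u w))))
    where
      entry : Fin n → Fin n → List (Fin n × Fin n)
      entry u w = if adj G u w ∧ (toℕ u <ᵇ toℕ w) then [ (u , w) ] else []
      rowList : Fin n → List (Fin n × Fin n)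
      rowList u = concatMap (entry u) (allFin n)
      single : ∀ u w → parity (length (entry u w)) ≡ adj G u w ∧ ascending u w
      single u w = parity-singleton (adj G u w ∧ ascending u w) (u , w)

  -- Two consistent orientations differ on a symmetric set of pairs, so the
  -- totals of their in-degree parities agree.
  oddIn-total-invariant : ∀ o o' → Antisymmetric o → Antisymmetric o' →
    ⨁ (oddIn o) ≡ ⨁ (oddIn o')
  oddIn-total-invariant o o' as as' = xor-false⇒≡ (begin
    ⨁ (oddIn o) xor ⨁ (oddIn o')
      ≡⟨ sym (∑-distrib-+ (oddIn o) (oddIn o')) ⟩
    ⨁ (λ w → oddIn o w xor oddIn o' w)
      ≡⟨ sum-cong-≗ (λ w → trans (sym (∑-distrib-+ (λ u → adj G u w ∧ o u w) (λ u → adj G u w ∧ o' u w)))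
                                 (sum-cong-≗ (λ u → sym (∧-distribˡ-xor (adj G u w) _ _)))) ⟩
    ⨁ (λ w → ⨁ (λ u → differ u w))
      ≡⟨ ⨁-symmetric (λ w u → differ u w) (λ w u → differ-sym u w) ⟩
    ⨁ (λ w → differ w w)
      ≡⟨ ⨁-zero _ (λ w → cong (_∧ _) (irrefl G w)) ⟩
    false ∎)
    where
      open ≡-Reasoning
      differ : Fin n → Fin n → Bool
      differ u w = adj G u w ∧ (o u w xor o' u w)
      differ-sym : ∀ u w → differ u w ≡ differ w u
      differ-sym u w with adj G u w in uw
      ... | false = sym (cong (_∧ _) (trans (SimpleGraph.sym G w u) uw))
      ... | true = begin
        o u w xor o' u w
          ≡⟨ cong₂ _xor_ (as u w h) (as' u w h) ⟩
        not (o w u) xor not (o' w u)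
          ≡⟨ xor-annihilates-not (o w u) (o' w u) ⟩
        o w u xor o' w u
          ≡⟨ cong (_∧ _) (adj-true (adj-sym h)) ⟨
        adj G w u ∧ (o w u xor o' w u) ∎
        where h = subst T (sym uw) _

  handshake : ∀ o → Antisymmetric o → ⨁ (oddIn o) ≡ parity (numEdges G)
  handshake o as = begin
    ⨁ (oddIn o)
      ≡⟨ oddIn-total-invariant o ascending as ascending-antisym ⟩
    ⨁ (λ w → ⨁ (λ u → adj G u w ∧ ascending u w))
      ≡⟨ ∑-comm (λ w u → adj G u w ∧ ascending u w) ⟩
    ⨁ (λ u → ⨁ (λ w → adj G u w ∧ ascending u w))
      ≡⟨ parity-numEdges ⟨
    parity (numEdges G) ∎
    where open ≡-Reasoning

  pairIndicator : Fin n → Fin n → Fin n → Fin n → Bool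
  pairIndicator a b u w = (u == a ∧ w == b) xor (u == b ∧ w == a)

  pairIndicator-sym : ∀ a b u w → pairIndicator a b w u ≡ pairIndicator a b u w
  pairIndicator-sym a b u w =
    trans (xor-comm (w == a ∧ u == b) (w == b ∧ u == a))
          (cong₂ _xor_ (∧-comm (w == b) (u == a)) (∧-comm (w == a) (u == b)))

  reverseEdge : Fin n → Fin n → Orientation → Orientation
  reverseEdge a b o u w = o u w xor pairIndicator a b u w

  reverseEdge-antisym : ∀ a b o → Antisymmetric o → Antisymmetric (reverseEdge a b o)
  reverseEdge-antisym a b o as u w h =
    trans (cong₂ _xor_ (as u w h) (sym (pairIndicator-sym a b u w)))
          (sym (not-distribˡ-xor (o w u) (pairIndicator a b w u)))

  reverseEdge-away : ∀ {a b} o x v → a ≢ v → b ≢ v → reverseEdge a b o x v ≡ o x v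
  reverseEdge-away {a} {b} o x v a≢v b≢v
    rewrite ≢⇒==false (b≢v ∘ sym) | ≢⇒==false (a≢v ∘ sym)
          | ∧-zeroʳ (x == a) | ∧-zeroʳ (x == b) = xor-identityʳ (o x v)

  ⨁-endpoint : ∀ {a b} w → T (adj G a b) → ⨁ (λ u → adj G u w ∧ (u == a ∧ w == b)) ≡ w == b
  ⨁-endpoint {a} {b} w ab = trans (⨁-supported _ a off) (at-a (w ≟ b))
    where
      off : ∀ u → u ≢ a → adj G u w ∧ (u == a ∧ w == b) ≡ false
      off u u≢a rewrite ≢⇒==false u≢a = ∧-zeroʳ (adj G u w)
      at-a : Dec (w ≡ b) → adj G a w ∧ (a == a ∧ w == b) ≡ w == b
      at-a (yes refl) rewrite ==-refl a | ==-refl w = trans (∧-identityʳ _) (adj-true ab)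
      at-a (no w≢b) rewrite ≢⇒==false w≢b | ∧-zeroʳ (a == a) = ∧-zeroʳ (adj G a w)

  oddIn-reverseEdge : ∀ {a b} o → T (adj G a b) → ∀ w →
    oddIn (reverseEdge a b o) w ≡ oddIn o w xor (w == b xor w == a)
  oddIn-reverseEdge {a} {b} o ab w = begin
    ⨁ (λ u → adj G u w ∧ (o u w xor pairIndicator a b u w))
      ≡⟨ sum-cong-≗ (λ u → ∧-distribˡ-xor (adj G u w) (o u w) _) ⟩
    ⨁ (λ u → (adj G u w ∧ o u w) xor (adj G u w ∧ pairIndicator a b u w))
      ≡⟨ ∑-distrib-+ (λ u → adj G u w ∧ o u w) _ ⟩
    oddIn o w xor ⨁ (λ u → adj G u w ∧ pairIndicator a b u w)
      ≡⟨ cong (oddIn o w xor_) (sum-cong-≗ (λ u → ∧-distribˡ-xor (adj G u w) _ _)) ⟩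
    oddIn o w xor ⨁ (λ u → (adj G u w ∧ (u == a ∧ w == b)) xor (adj G u w ∧ (u == b ∧ w == a)))
      ≡⟨ cong (oddIn o w xor_) (∑-distrib-+ (λ u → adj G u w ∧ (u == a ∧ w == b)) _) ⟩
    oddIn o w xor (⨁ (λ u → adj G u w ∧ (u == a ∧ w == b))
                   xor ⨁ (λ u → adj G u w ∧ (u == b ∧ w == a)))
      ≡⟨ cong (oddIn o w xor_) (cong₂ _xor_ (⨁-endpoint w ab) (⨁-endpoint w (adj-sym ab))) ⟩
    oddIn o w xor (w == b xor w == a) ∎
    where open ≡-Reasoning

  Avoiding : Fin n → Fin n → Fin n → Set
  Avoiding v u w = T (adj G u w) × u ≢ v × w ≢ v

  PathAvoiding : Fin n → Fin n → Fin n → Set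
  PathAvoiding v = Star (Avoiding v)

  pathAvoiding-sym : ∀ {v} → Symmetric (PathAvoiding v)
  pathAvoiding-sym = reverseStar (λ (h , u≢v , w≢v) → adj-sym h , w≢v , u≢v)

  reversePath : ∀ {v s t} → PathAvoiding v s t → Orientation → Orientation
  reversePath ε o = o
  reversePath (_◅_ {u} {w} _ rest) o = reversePath rest (reverseEdge u w o)

  reversePath-antisym : ∀ {v s t} (P : PathAvoiding v s t) o → Antisymmetric o →
    Antisymmetric (reversePath P o)
  reversePath-antisym ε o as = as
  reversePath-antisym (_◅_ {u} {w} _ rest) o as =
    reversePath-antisym rest (reverseEdge u w o) (reverseEdge-antisym u w o as)

  reversePath-away : ∀ {v s t} (P : PathAvoiding v s t) o x → reversePath P o x v ≡ o x v
  reversePath-away ε o x = refl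
  reversePath-away {v} (_◅_ {u} {w} (_ , u≢v , w≢v) rest) o x =
    trans (reversePath-away rest (reverseEdge u w o) x) (reverseEdge-away o x v u≢v w≢v)

  -- Reversing a path from s to t changes the in-degree parity exactly at s and t
  -- (intermediate vertices are toggled twice).
  oddIn-reversePath : ∀ {v s t} (P : PathAvoiding v s t) o x →
    oddIn (reversePath P o) x ≡ oddIn o x xor (x == s xor x == t)
  oddIn-reversePath {s = s} ε o x =
    sym (trans (cong (oddIn o x xor_) (xor-same (x == s))) (xor-identityʳ _))
  oddIn-reversePath {t = t} (_◅_ {u} {w} (uw , _) rest) o x = begin
    oddIn (reversePath rest (reverseEdge u w o)) x
      ≡⟨ oddIn-reversePath rest (reverseEdge u w o) x ⟩
    oddIn (reverseEdge u w o) x xor (x == w xor x == t)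
      ≡⟨ cong (_xor (x == w xor x == t)) (oddIn-reverseEdge o uw x) ⟩
    (oddIn o x xor (x == w xor x == u)) xor (x == w xor x == t)
      ≡⟨ xor-assoc (oddIn o x) _ _ ⟩
    oddIn o x xor ((x == w xor x == u) xor (x == w xor x == t))
      ≡⟨ cong (oddIn o x xor_) (xor-cancelˡ (x == w) (x == u) (x == t)) ⟩
    oddIn o x xor (x == u xor x == t) ∎
    where open ≡-Reasoning

  firstArrival : ∀ {v s} (D : Fin n → Fin n → Bool) → (∀ {u w} → T (D u w) → T (adj G u w)) →
    Walk D s v → s ≢ v → Σ[ u ∈ Fin n ] (T (D u v) × PathAvoiding v s u)
  firstArrival D D⊆G [] s≢v = ⊥-elim (s≢v refl)
  firstArrival {v} {s} D D⊆G (_∷_ {v = t} step rest) s≢v with t ≟ v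
  ... | yes refl = s , step , ε
  ... | no t≢v with firstArrival D D⊆G rest t≢v
  ... | u , last , path = u , last , (D⊆G step , s≢v , t≢v) ◅ path

  record Neighbours (v x y z : Fin n) : Set where
    field
      adj-x : T (adj G v x)
      adj-y : T (adj G v y)
      adj-z : T (adj G v z)
      x≢y : x ≢ y
      x≢z : x ≢ z
      y≢z : y ≢ z
      cover : ∀ w → T (adj G v w) → w ≡ x ⊎ w ≡ y ⊎ w ≡ z

  neighbours : Cubic G → ∀ v → Σ[ x ∈ Fin n ] Σ[ y ∈ Fin n ] Σ[ z ∈ Fin n ] Neighbours v x y z
  neighbours cub v with cub v
  ... | x , y , z , vx , vy , vz , x≢y , x≢z , y≢z , cover =
    x , y , z , record { adj-x = vx ; adj-y = vy ; adj-z = vz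
                       ; x≢y = x≢y ; x≢z = x≢z ; y≢z = y≢z ; cover = cover }

  swap₁₂ : ∀ {v x y z} → Neighbours v x y z → Neighbours v y x z
  swap₁₂ N = record
    { adj-x = adj-y ; adj-y = adj-x ; adj-z = adj-z
    ; x≢y = x≢y ∘ sym ; x≢z = y≢z ; y≢z = x≢z
    ; cover = λ w h → [ inj₂ ∘ inj₁ , [ inj₁ , inj₂ ∘ inj₂ ]′ ]′ (cover w h) }
    where open Neighbours N

  swap₁₃ : ∀ {v x y z} → Neighbours v x y z → Neighbours v z y x
  swap₁₃ N = record
    { adj-x = adj-z ; adj-y = adj-y ; adj-z = adj-x
    ; x≢y = y≢z ∘ sym ; x≢z = x≢z ∘ sym ; y≢z = x≢y ∘ sym
    ; cover = λ w h → [ inj₂ ∘ inj₂ , [ inj₂ ∘ inj₁ , inj₁ ]′ ]′ (cover w h) }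
    where open Neighbours N

  neighboursFrom : ∀ {v x y z u} → Neighbours v x y z → T (adj G v u) →
    Σ[ y' ∈ Fin n ] Σ[ z' ∈ Fin n ] Neighbours v u y' z'
  neighboursFrom {x = x} {y} {z} {u} N h with Neighbours.cover N u h
  ... | inj₁ refl = y , z , N
  ... | inj₂ (inj₁ refl) = x , z , swap₁₂ N
  ... | inj₂ (inj₂ refl) = y , x , swap₁₃ N

  neighbour-indicator : ∀ {w x y z} → Neighbours w x y z → ∀ u →
    adj G u w ≡ u == x xor (u == y xor u == z)
  neighbour-indicator {w} {x} {y} {z} N u with u ≟ x
  ... | yes refl rewrite ≢⇒==false (Neighbours.x≢y N) | ≢⇒==false (Neighbours.x≢z N) =
    adj-true (adj-sym (Neighbours.adj-x N))
  ... | no u≢x with u ≟ y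
  ... | yes refl rewrite ≢⇒==false (Neighbours.y≢z N) = adj-true (adj-sym (Neighbours.adj-y N))
  ... | no u≢y with u ≟ z
  ... | yes refl = adj-true (adj-sym (Neighbours.adj-z N))
  ... | no u≢z with adj G u w in uw
  ... | false = refl
  ... | true with Neighbours.cover N u (adj-sym (subst T (sym uw) _))
  ... | inj₁ u≡x = ⊥-elim (u≢x u≡x)
  ... | inj₂ (inj₁ u≡y) = ⊥-elim (u≢y u≡y)
  ... | inj₂ (inj₂ u≡z) = ⊥-elim (u≢z u≡z)

  oddIn-neighbours : ∀ o {w x y z} → Neighbours w x y z →
    oddIn o w ≡ o x w xor (o y w xor o z w)
  oddIn-neighbours o {w} {x} {y} {z} N = begin
    ⨁ (λ u → adj G u w ∧ o u w)
      ≡⟨ sum-cong-≗ (λ u → trans (cong (_∧ o u w) (neighbour-indicator N u)) (distrib u)) ⟩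
    ⨁ (λ u → (u == x ∧ o u w) xor ((u == y ∧ o u w) xor (u == z ∧ o u w)))
      ≡⟨ ∑-distrib-+ (λ u → u == x ∧ o u w) _ ⟩
    ⨁ (λ u → u == x ∧ o u w) xor ⨁ (λ u → (u == y ∧ o u w) xor (u == z ∧ o u w))
      ≡⟨ cong (⨁ (λ u → u == x ∧ o u w) xor_) (∑-distrib-+ (λ u → u == y ∧ o u w) _) ⟩
    ⨁ (λ u → u == x ∧ o u w) xor (⨁ (λ u → u == y ∧ o u w) xor ⨁ (λ u → u == z ∧ o u w))
      ≡⟨ cong₂ _xor_ (⨁-point x (λ u → o u w))
                     (cong₂ _xor_ (⨁-point y (λ u → o u w)) (⨁-point z (λ u → o u w))) ⟩
    o x w xor (o y w xor o z w) ∎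
    where
      open ≡-Reasoning
      distrib : ∀ u → (u == x xor (u == y xor u == z)) ∧ o u w
                    ≡ (u == x ∧ o u w) xor ((u == y ∧ o u w) xor (u == z ∧ o u w))
      distrib u = trans (∧-distribʳ-xor (o u w) (u == x) _)
                        (cong ((u == x ∧ o u w) xor_) (∧-distribʳ-xor (o u w) (u == y) (u == z)))

  module _ (con : Connected G) (br : Bridgeless G) (v : Fin n) where

    toNeighbour : ∀ w → w ≢ v → Σ[ u ∈ Fin n ] (T (adj G u v) × PathAvoiding v w u)
    toNeighbour w w≢v = firstArrival (adj G) id (con w v) w≢v

    -- Since pv is not a bridge, p walks to v without using pv, and so reaches
    -- another neighbour of v in G − v.
    neighbourToNeighbour : ∀ {p} → T (adj G v p) →
      Σ[ u ∈ Fin n ] (T (adj G u v) × u ≢ p × PathAvoiding v p u)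
    neighbourToNeighbour {p} vp with edgeOf v p vp
    ... | E , ends with firstArrival (deleteEdge G (proj₁ E)) (deleteEdge⊆adj (proj₁ E))
                                     (br E p v) (adj⇒≢ vp ∘ sym)
    ... | u , last , path =
      u , deleteEdge⊆adj (proj₁ E) last , (λ { refl → deleteEdge-removes {E} ends last }) , path

    reachesOther : ∀ {p q r} → Neighbours v p q r → PathAvoiding v p q ⊎ PathAvoiding v p r
    reachesOther N with neighbourToNeighbour (Neighbours.adj-x N)
    ... | u , uv , u≢p , path with Neighbours.cover N u (adj-sym uv)
    ... | inj₁ u≡p = ⊥-elim (u≢p u≡p)
    ... | inj₂ (inj₁ refl) = inj₁ path
    ... | inj₂ (inj₂ refl) = inj₂ path

    reachNeighbour : Cubic G → ∀ {a} → T (adj G v a) → ∀ w → w ≢ v → PathAvoiding v w a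
    reachNeighbour cub va w w≢v with neighbours cub v | toNeighbour w w≢v
    ... | x , y , z , N | u , uv , w~u =
      w~u ◅◅ toX (adj-sym uv) ◅◅ pathAvoiding-sym (toX va)
      where
        joined : PathAvoiding v y x × PathAvoiding v z x
        joined = triangle {_~_ = PathAvoiding v} pathAvoiding-sym _◅◅_
                          (reachesOther N) (reachesOther (swap₁₂ N))
                          (swap (reachesOther (swap₁₃ N)))
        toX : ∀ {u} → T (adj G v u) → PathAvoiding v u x
        toX {u} vu with Neighbours.cover N u vu
        ... | inj₁ refl = ε
        ... | inj₂ (inj₁ refl) = proj₁ joined
        ... | inj₂ (inj₂ refl) = proj₂ joined

  -- Given paths in G − v from every w ≠ v to a, a consistent
  -- orientation o₀ can be changed away from v so that every vertex other than
  -- v and a has even in-degree: reverse a path from each odd such vertex to a.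
  module Repair {v a : Fin n} (reach : ∀ w → w ≢ v → PathAvoiding v w a) (o₀ : Orientation) where

    Admissible : Orientation → Set
    Admissible o = Antisymmetric o × (∀ x → o x v ≡ o₀ x v)

    EvenAt : Orientation → Fin n → Set
    EvenAt o w = w ≢ v → w ≢ a → oddIn o w ≡ false

    fixAt : ∀ o → Admissible o → ∀ w →
      Σ[ o' ∈ Orientation ] (Admissible o' × EvenAt o' w × (∀ {x} → EvenAt o x → EvenAt o' x))
    fixAt o adm w with w ≟ v | w ≟ a | oddIn o w in parityW
    ... | yes w≡v | _ | _ = o , adm , (λ w≢v _ → ⊥-elim (w≢v w≡v)) , id
    ... | no _ | yes w≡a | _ = o , adm , (λ _ w≢a → ⊥-elim (w≢a w≡a)) , id
    ... | no _ | no _ | false = o , adm , (λ _ _ → parityW) , id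
    ... | no w≢v | no w≢a | true =
      reversePath P o , admissible , evenW , preserved
      where
        P = reach w w≢v
        admissible : Admissible (reversePath P o)
        admissible = reversePath-antisym P o (proj₁ adm) ,
                     λ x → trans (reversePath-away P o x) (proj₂ adm x)
        evenW : EvenAt (reversePath P o) w
        evenW _ _ rewrite oddIn-reversePath P o w | parityW | ==-refl w | ≢⇒==false w≢a = refl
        preserved : ∀ {x} → EvenAt o x → EvenAt (reversePath P o) x
        preserved {x} evenX x≢v x≢a with x ≟ w
        ... | yes refl = evenW x≢v x≢a
        ... | no x≢w rewrite oddIn-reversePath P o x | ≢⇒==false x≢w | ≢⇒==false x≢a =
          trans (xor-identityʳ _) (evenX x≢v x≢a)

    repairList : Antisymmetric o₀ → (L : List (Fin n)) →
      Σ[ o ∈ Orientation ] (Admissible o × All (EvenAt o) L)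
    repairList as₀ [] = o₀ , (as₀ , λ _ → refl) , []
    repairList as₀ (w ∷ L) with repairList as₀ L
    ... | o , adm , evens with fixAt o adm w
    ... | o' , adm' , evenW , preserved = o' , adm' , evenW ∷ All.map preserved evens

    repair : Antisymmetric o₀ → Σ[ o ∈ Orientation ] (Admissible o × (∀ w → EvenAt o w))
    repair as₀ with repairList as₀ (allFin n)
    ... | o , adm , evens = o , adm , λ w → All.lookup evens (∈-allFin w)

  towards : Fin n → Fin n → Fin n → Orientation
  towards v a b u w =
    if w == v then (u == a ∨ u == b) else if u == v then not (w == a ∨ w == b) else ascending u w

  towards-antisym : ∀ v a b → Antisymmetric (towards v a b)
  towards-antisym v a b u w h with w ≟ v | u ≟ v
  ... | yes refl | yes refl = ⊥-elim (adj⇒≢ h refl)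
  ... | yes refl | no _ = sym (not-involutive _)
  ... | no _ | yes refl = refl
  ... | no _ | no _ = ascending-antisym u w h

  towards-into : ∀ v a b x → towards v a b x v ≡ (x == a ∨ x == b)
  towards-into v a b x rewrite ==-refl v = refl

  evenOrientation : Connected G → Bridgeless G → Cubic G → 2 ∣ numEdges G →
    ∀ {v a b} → T (adj G v a) → T (adj G v b) → a ≢ b →
    Σ[ o ∈ Orientation ]
      (Antisymmetric o × (∀ w → oddIn o w ≡ false) × o a v ≡ true × o b v ≡ true)
  evenOrientation con br cub evenEdges {v} {a} {b} va vb a≢b
    with Repair.repair (reachNeighbour con br v cub va) (towards v a b) (towards-antisym v a b)
  ... | o , (as , atV) , evenAway = o , as , allEven , aIntoV , bIntoV
    where
      intoV : ∀ x → o x v ≡ (x == a ∨ x == b)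
      intoV x = trans (atV x) (towards-into v a b x)

      aIntoV : o a v ≡ true
      aIntoV rewrite intoV a | ==-refl a = refl

      bIntoV : o b v ≡ true
      bIntoV rewrite intoV b | ==-refl b = ∨-zeroʳ (b == a)

      evenV : oddIn o v ≡ false
      evenV = begin
        ⨁ (λ u → adj G u v ∧ o u v)
          ≡⟨ sum-cong-≗ term ⟩
        ⨁ (λ u → u == a xor u == b)
          ≡⟨ ∑-distrib-+ (_== a) (_== b) ⟩
        ⨁ (_== a) xor ⨁ (_== b)
          ≡⟨ cong₂ _xor_ (⨁-indicator a) (⨁-indicator b) ⟩
        false ∎
        where
          open ≡-Reasoning
          term : ∀ u → adj G u v ∧ o u v ≡ (u == a xor u == b)
          term u rewrite intoV u with u ≟ a | u ≟ b
          ... | yes refl | yes refl = ⊥-elim (a≢b refl)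
          ... | yes refl | no _ = trans (∧-identityʳ _) (adj-true (adj-sym va))
          ... | no _ | yes refl = trans (∧-identityʳ _) (adj-true (adj-sym vb))
          ... | no _ | no _ = ∧-zeroʳ _

      evenOffA : ∀ w → w ≢ a → oddIn o w ≡ false
      evenOffA w w≢a with w ≟ v
      ... | yes refl = evenV
      ... | no w≢v = evenAway w w≢v w≢a

      -- The parity at a is forced by the handshake lemma.
      evenA : oddIn o a ≡ false
      evenA = begin
        oddIn o a                ≡⟨ ⨁-supported (oddIn o) a evenOffA ⟨
        ⨁ (oddIn o)              ≡⟨ handshake o as ⟩
        parity (numEdges G)      ≡⟨ parity-even evenEdges ⟩
        false ∎
        where open ≡-Reasoning

      allEven : ∀ w → oddIn o w ≡ false
      allEven w with w ≟ a
      ... | yes refl = evenA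
      ... | no w≢a = evenOffA w w≢a

  module Matching (o : Orientation) (as : Antisymmetric o) (cub : Cubic G)
                  (even : ∀ w → oddIn o w ≡ false) where

    Into : Fin n → Fin n → Set
    Into t w = T (adj G t w) × o t w ≡ true

    -- Every in-neighbour u of w has exactly one other in-neighbour: w has
    -- three neighbours and an even number of them point inwards.
    partner : ∀ {u w} → Into u w →
      Σ[ t ∈ Fin n ] (Into t w × t ≢ u × (∀ t' → Into t' w → t' ≡ u ⊎ t' ≡ t))
    partner {u} {w} (uw , ou) with neighbours cub w
    ... | _ , _ , _ , N₀ with neighboursFrom N₀ (adj-sym uw)
    ... | y , z , N = choose (true-xor≡false (begin
      true xor (o y w xor o z w)   ≡⟨ cong (_xor (o y w xor o z w)) ou ⟨
      o u w xor (o y w xor o z w)  ≡⟨ oddIn-neighbours o N ⟨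
      oddIn o w                    ≡⟨ even w ⟩
      false ∎))
      where
        open ≡-Reasoning
        open Neighbours N
        choose : o y w xor o z w ≡ true →
          Σ[ t ∈ Fin n ] (Into t w × t ≢ u × (∀ t' → Into t' w → t' ≡ u ⊎ t' ≡ t))
        choose odd with o y w in oy | o z w in oz
        ... | true | false = y , (adj-sym adj-y , oy) , x≢y ∘ sym , onlyY
          where
            onlyY : ∀ t' → Into t' w → t' ≡ u ⊎ t' ≡ y
            onlyY t' (t'w , ot') with cover t' (adj-sym t'w)
            ... | inj₁ t'≡u = inj₁ t'≡u
            ... | inj₂ (inj₁ t'≡y) = inj₂ t'≡y
            ... | inj₂ (inj₂ refl) with trans (sym ot') oz
            ... | ()
        ... | false | true = z , (adj-sym adj-z , oz) , x≢z ∘ sym , onlyZ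
          where
            onlyZ : ∀ t' → Into t' w → t' ≡ u ⊎ t' ≡ z
            onlyZ t' (t'w , ot') with cover t' (adj-sym t'w)
            ... | inj₁ t'≡u = inj₁ t'≡u
            ... | inj₂ (inj₂ t'≡z) = inj₂ t'≡z
            ... | inj₂ (inj₁ refl) with trans (sym ot') oy
            ... | ()
        choose () | true | true
        choose () | false | false

    Directed : Edge G → Fin n → Fin n → Set
    Directed E p q = Ends E p q × o p q ≡ true

    direction : ∀ E → Σ[ p ∈ Fin n ] Σ[ q ∈ Fin n ] Directed E p q
    direction ((p , q) , _ , pq) with o p q in opq
    ... | true = p , q , inj₁ refl , opq
    ... | false = q , p , inj₂ refl , trans (as q p (adj-sym pq)) (cong not opq)

    not-both : ∀ {c d} → T (adj G c d) → o c d ≡ true → o d c ≡ true → ⊥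
    not-both {c} {d} cd ocd odc with trans (sym ocd) (trans (as c d cd) (cong not odc))
    ... | ()

    directed-unique : ∀ {E p q p' q'} → Directed E p q → Directed E p' q' → p ≡ p' × q ≡ q'
    directed-unique {(c , d) , _ , _} (inj₁ refl , _) (inj₁ refl , _) = refl , refl
    directed-unique {(c , d) , _ , _} (inj₂ refl , _) (inj₂ refl , _) = refl , refl
    directed-unique {(c , d) , _ , cd} (inj₁ refl , ocd) (inj₂ refl , odc) =
      ⊥-elim (not-both cd ocd odc)
    directed-unique {(c , d) , _ , cd} (inj₂ refl , odc) (inj₁ refl , ocd) =
      ⊥-elim (not-both cd ocd odc)

    tail head : Edge G → Fin n
    tail E = proj₁ (direction E)
    head E = proj₁ (proj₂ (direction E))

    directed : ∀ E → Directed E (tail E) (head E)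
    directed E = proj₂ (proj₂ (direction E))

    directed⇒tail-head : ∀ {E p q} → Directed E p q → tail E ≡ p × head E ≡ q
    directed⇒tail-head {E} = directed-unique {E} (directed E)

    tail-head-injective : ∀ E E' → tail E ≡ tail E' → head E ≡ head E' → E ≡ E'
    tail-head-injective E E' t≡t' h≡h' =
      ends-unique E E' (proj₁ (directed E))
                  (subst₂ (Ends E') (sym t≡t') (sym h≡h') (proj₁ (directed E')))

    head-end : ∀ E → head E ≡ proj₁ (proj₁ E) ⊎ head E ≡ proj₂ (proj₁ E)
    head-end E with proj₁ (directed E)
    ... | inj₁ e = inj₂ (sym (cong proj₂ e))
    ... | inj₂ e = inj₁ (sym (cong proj₁ e))

    sharedHead : ∀ E E' → head E ≡ head E' → ShareEnd (proj₁ E) (proj₁ E')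
    sharedHead E E' h with head-end E | head-end E'
    ... | inj₁ a | inj₁ b = inj₁ (trans (sym a) (trans h b))
    ... | inj₁ a | inj₂ b = inj₂ (inj₁ (trans (sym a) (trans h b)))
    ... | inj₂ a | inj₁ b = inj₂ (inj₂ (inj₁ (trans (sym a) (trans h b))))
    ... | inj₂ a | inj₂ b = inj₂ (inj₂ (inj₂ (trans (sym a) (trans h b))))

    SameHead : Edge G → Edge G → Set
    SameHead E E' = E ≢ E' × head E ≡ head E'

    into : ∀ E → Into (tail E) (head E)
    into E = ends-adj {E} (proj₁ (directed E)) , proj₂ (directed E)

    matchedEdge : ∀ E → Σ[ E' ∈ Edge G ] (SameHead E E' × (∀ Z → SameHead E Z → Z ≡ E'))
    matchedEdge E with partner (into E)
    ... | t , (tw , ot) , t≢u , only with edgeOf t (head E) tw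
    ... | E' , ends' with directed⇒tail-head {E'} (ends' , ot)
    ... | tail≡t , head≡w = E' , (E≢E' , sym head≡w) , unique
      where
        E≢E' : E ≢ E'
        E≢E' refl = t≢u (sym tail≡t)
        unique : ∀ Z → SameHead E Z → Z ≡ E'
        unique Z (E≢Z , hE≡hZ) with only (tail Z) (subst (Into (tail Z)) (sym hE≡hZ) (into Z))
        ... | inj₁ tZ≡tE = ⊥-elim (E≢Z (tail-head-injective E Z (sym tZ≡tE) hE≡hZ))
        ... | inj₂ tZ≡t =
          tail-head-injective Z E' (trans tZ≡t (sym tail≡t)) (trans (sym hE≡hZ) (sym head≡w))

    sameHead-perfect : IsPerfectMatching (LAdj G) SameHead
    sameHead-perfect = (λ E E' (E≢E' , h) → E≢E' , sharedHead E E' h)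
                     , (λ E E' (E≢E' , h) → E≢E' ∘ sym , sym h)
                     , matchedEdge

lemma2 : (n : ℕ) (G : SimpleGraph n)
    → Connected G → Bridgeless G → Cubic G → 2 ∣ numEdges G
    → (e f : Edge G) → LAdj G e f
    → Σ[ M ∈ (Edge G → Edge G → Set) ] (IsPerfectMatching (LAdj G) M × M e f)
lemma2 n G con br cub evenEdges e f (e≢f , share)
  with commonVertex G e f share
... | v , a , b , ends-e , ends-f , va , vb
  with evenOrientation G con br cub evenEdges va vb (distinctEnds G e≢f ends-e ends-f)
... | o , as , even , av , bv = SameHead , sameHead-perfect , e≢f , trans head-e (sym head-f)
  where
    open Matching G o as cub even
    head-e : head e ≡ v
    head-e = proj₂ (directed⇒tail-head {e} (ends-swap G {e} ends-e , av))
    head-f : head f ≡ v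
    head-f = proj₂ (directed⇒tail-head {f} (ends-swap G {f} ends-f , bv))
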